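{- Let $A=(a_1,\ldots,a_m)$ be a tuple of positive integers that has an EPS schedule, and let $L=\mathrm{lcm}(a_1,\ldots,a_m)$. Let $B=(b_1,\ldots,b_n)$ be positive integers with $L\mid b_i$ for all $1\le i\le n$ and $b_i\mid b_j$ for all $1\le i\le j\le n$. Let $C=A\sqcup B$ (the concatenation of the two lists) and suppose $D(C)\le1$. Then $C$ has an EPS schedule.
   Context: For a tuple $X=(x_1,\ldots,x_k)$ of positive integers, $D(X)=\sum_i 1/x_i$. An EPS (exact pinwheel scheduling) schedule for $X$ is a function $\sigma:\mathbb{Z}\to\{1,\ldots,k\}\cup\{\bot\}$ such that for each task $i$, the set $\sigma^{ -1}(\{i\})$ is nonempty and any two consecutive occurrences of task $i$ are exactly $x_i$ apart (i.e. $\sigma^{ -1}(\{i\})$ is a full congruence class modulo $x_i$). -}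

module Defs where

open import Data.Nat using (ℕ; zero; suc)
open import Data.Integer as ℤ using (ℤ; +_; _-_)
open import Data.Integer.Divisibility as ℤD using ()
open import Data.Rational using (ℚ; _/_; _+_; 0ℚ)
open import Data.List using (List; length; lookup; foldr; map)
open import Data.Fin using (Fin)
open import Data.Nat.LCM using (lcm)
open import Data.Maybe using (Maybe; just)
open import Data.Product using (Σ; _×_)
open import Relation.Binary.PropositionalEquality using (_≡_)
open import Function.Bundles using (_⇔_)

-- A tuple of positive integers is a list of naturals (positivity stated separately).
-- Reciprocal 1/x (the value at 0 is irrelevant: only used for positive x).
recip : ℕ → ℚ
recip zero    = 0ℚ
recip (suc n) = + 1 / suc n

D : List ℕ → ℚ
D xs = foldr (λ x s → recip x + s) 0ℚ xs

-- EPS schedule: σ : ℤ → {1..k} ∪ {⊥}, modelled as ℤ → Maybe (Fin k),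
-- such that for each task i, σ⁻¹({i}) is a full congruence class mod x_i
-- (in particular nonempty).
IsEPSSchedule : (X : List ℕ) → (ℤ → Maybe (Fin (length X))) → Set
IsEPSSchedule X σ =
  (i : Fin (length X)) →
    Σ ℤ λ r → (t : ℤ) → (σ t ≡ just i) ⇔ ((+ lookup X i) ℤD.∣ (t - r))

HasEPS : List ℕ → Set
HasEPS X = Σ (ℤ → Maybe (Fin (length X))) λ σ → IsEPSSchedule X σ

lcmList : List ℕ → ℕ
lcmList = foldr lcm 1

-- Add the elements of B one at a time, in increasing order.  When b is added, every period a
-- already scheduled divides b, so within the window 0, 1, …, b − 1 the task with period a
-- occupies at most b / a slots.  Since D(A) + 1/b ≤ 1, the sum of the b / a is less than b,
-- so some slot t of the window is free; and it stays free modulo b, because a slot congruent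
-- to t modulo b is congruent to t modulo every a.  Hence the new task can run at t + bℤ.
module Submission where

open import Defs
open import Data.Nat using (ℕ; _<_)
open import Data.Nat.Divisibility using (_∣_)
open import Data.List using (List; length; lookup; _++_)
open import Data.List.Relation.Unary.All using (All)
open import Data.Fin using (Fin) renaming (_≤_ to _≤ᶠ_)
open import Data.Rational using (1ℚ) renaming (_≤_ to _≤ℚ_)

open import Data.Nat using (zero; suc; _+_; _*_; _≤_; z≤n; s≤s)
open import Data.Nat.Properties
  using ( +-comm; +-assoc; +-mono-≤; *-zeroʳ; ≤-reflexive; ≤-trans; ≤-pred; ≤-<-trans
        ; m≤n+m; m<n⇒m<1+n; n<1+n; <⇒≢; ⊔-lub; +-cancelˡ-≡; +-0-commutativeMonoid
        ; module ≤-Reasoning )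
open import Data.Nat.Divisibility using (divides; _∣?_; ∣-trans; ∣-refl; >⇒∤)
open import Data.Nat.LCM using (m∣lcm[m,n]; n∣lcm[m,n])
open import Data.Integer as ℤ using (ℤ; +_; _-_; ∣_∣)
import Data.Integer.Properties as ℤP
import Data.Integer.Divisibility as ℤD
import Data.Integer.Divisibility.Signed as ℤS
import Data.Integer.Tactic.RingSolver as ℤSolver
open import Data.Rational using (toℚᵘ)
import Data.Rational.Properties as ℚP
open import Data.Rational.Unnormalised as ℚᵘ using (ℚᵘ; mkℚᵘ; _≃_; *≡*; *≤*; 0ℚᵘ; 1ℚᵘ)
import Data.Rational.Unnormalised.Properties as ℚᵘP
open import Data.List using ([]; _∷_; [_]; foldr)
open import Data.List.Properties using (++-assoc; ++-identityʳ)
open import Data.List.Relation.Unary.All as All using ([]; _∷_)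
open import Data.List.Relation.Unary.All.Properties using (++⁺)
open import Data.List.Relation.Unary.AllPairs using (AllPairs; []; _∷_)
open import Data.List.Relation.Unary.Any as Any using ()
open import Data.List.Relation.Unary.Any.Properties using (lookup-index)
open import Data.List.Membership.Propositional.Properties using (∈-lookup)
open import Data.Fin using (zero; suc)
import Data.Fin.Properties as FinP
open import Data.Maybe using (Maybe; just; nothing)
import Data.Maybe as Maybe
open import Data.Maybe.Properties using (just-injective)
open import Data.Product using (∃-syntax; _,_; proj₁; proj₂)
open import Function using (_∘_)
open import Function.Bundles using (_⇔_; mk⇔; Equivalence)
open import Relation.Nullary using (Dec; yes; no; contradiction)
open import Relation.Binary.PropositionalEquality
  using (_≡_; _≢_; refl; sym; trans; cong; cong₂; subst; module ≡-Reasoning)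
open import Algebra.Properties.CommutativeMonoid.Sum +-0-commutativeMonoid
  using (sum-syntax; ∑-distrib-+; sum-replicate-zero)

sumBelow : ℕ → (ℕ → ℕ) → ℕ
sumBelow zero    f = 0
sumBelow (suc n) f = f n + sumBelow n f

sumBelow-cong : ∀ n {f g : ℕ → ℕ} → (∀ t → f t ≡ g t) → sumBelow n f ≡ sumBelow n g
sumBelow-cong zero    f≗g = refl
sumBelow-cong (suc n) f≗g = cong₂ _+_ (f≗g n) (sumBelow-cong n f≗g)

sumBelow-+ : ∀ m n (f : ℕ → ℕ) → sumBelow (m + n) f ≡ sumBelow m (λ t → f (n + t)) + sumBelow n f
sumBelow-+ zero    n f = refl
sumBelow-+ (suc m) n f rewrite sumBelow-+ m n f | +-comm m n = sym (+-assoc (f (n + m)) _ _)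

sumBelow-∑ : ∀ n {k} (g : Fin k → ℕ → ℕ) →
  sumBelow n (λ t → ∑[ i < k ] g i t) ≡ ∑[ i < k ] sumBelow n (g i)
sumBelow-∑ zero    {k} g = sym (sum-replicate-zero k)
sumBelow-∑ (suc n) {k} g = begin
  ∑[ i < k ] g i n + sumBelow n (λ t → ∑[ i < k ] g i t)  ≡⟨ cong (_+_ (∑[ i < k ] g i n)) (sumBelow-∑ n g) ⟩
  ∑[ i < k ] g i n + ∑[ i < k ] sumBelow n (g i)          ≡⟨ ∑-distrib-+ (λ i → g i n) (λ i → sumBelow n (g i)) ⟨
  ∑[ i < k ] (g i n + sumBelow n (g i))                   ∎
  where open ≡-Reasoning

∑-mono-≤ : ∀ {k} {f g : Fin k → ℕ} → (∀ i → f i ≤ g i) → ∑[ i < k ] f i ≤ ∑[ i < k ] g i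
∑-mono-≤ {zero}  f≤g = z≤n
∑-mono-≤ {suc k} f≤g = +-mono-≤ (f≤g zero) (∑-mono-≤ (f≤g ∘ suc))

sumBelow<n⇒∃zero : ∀ n (f : ℕ → ℕ) → sumBelow n f < n → ∃[ t ] f t ≡ 0
sumBelow<n⇒∃zero (suc n) f sum<n with f n in fn≡
... | zero  = n , fn≡
... | suc m = sumBelow<n⇒∃zero n f (≤-trans (s≤s (m≤n+m _ m)) (≤-pred sum<n))

sumBelow-zero : ∀ n (f : ℕ → ℕ) → (∀ t → t < n → f t ≡ 0) → sumBelow n f ≡ 0
sumBelow-zero zero    f f≡0 = refl
sumBelow-zero (suc n) f f≡0 rewrite f≡0 n (n<1+n n) =
  sumBelow-zero n f (λ t t<n → f≡0 t (m<n⇒m<1+n t<n))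

sumBelow≤1 : ∀ n (f : ℕ → ℕ) → (∀ t → f t ≤ 1) →
  (∀ {x y} → x < n → y < n → f x ≡ 1 → f y ≡ 1 → x ≡ y) → sumBelow n f ≤ 1
sumBelow≤1 zero    f f≤1 unique = z≤n
sumBelow≤1 (suc n) f f≤1 unique with f n in fn≡ | f≤1 n
... | zero        | _     = sumBelow≤1 n f f≤1 (λ x<n y<n → unique (m<n⇒m<1+n x<n) (m<n⇒m<1+n y<n))
... | suc (suc _) | s≤s ()
... | suc zero    | _     = ≤-reflexive (cong suc (sumBelow-zero n f vanish))
  where
  vanish : ∀ t → t < n → f t ≡ 0
  vanish t t<n with f t in ft≡ | f≤1 t
  ... | zero        | _     = refl
  ... | suc zero    | _     = contradiction (unique (m<n⇒m<1+n t<n) (n<1+n n) ft≡ fn≡) (<⇒≢ t<n)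
  ... | suc (suc _) | s≤s ()

sumBelow-blocks : ∀ q a (f : ℕ → ℕ) → (∀ s → sumBelow a (λ t → f (s + t)) ≤ 1) → sumBelow (q * a) f ≤ q
sumBelow-blocks zero    a f window = z≤n
sumBelow-blocks (suc q) a f window rewrite sumBelow-+ a (q * a) f =
  +-mono-≤ (window (q * a)) (sumBelow-blocks q a f window)

δ : ∀ {k} → Fin k → Fin k → ℕ
δ zero    zero    = 1
δ zero    (suc _) = 0
δ (suc _) zero    = 0
δ (suc i) (suc j) = δ i j

δ≤1 : ∀ {k} (i j : Fin k) → δ i j ≤ 1
δ≤1 zero    zero    = s≤s z≤n
δ≤1 zero    (suc _) = z≤n
δ≤1 (suc _) zero    = z≤n
δ≤1 (suc i) (suc j) = δ≤1 i j

δ≡1⇒≡ : ∀ {k} (i j : Fin k) → δ i j ≡ 1 → i ≡ j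
δ≡1⇒≡ zero    zero    _ = refl
δ≡1⇒≡ (suc i) (suc j) e = cong suc (δ≡1⇒≡ i j e)

∑δ≡1 : ∀ {k} (i : Fin k) → ∑[ j < k ] δ i j ≡ 1
∑δ≡1 {suc k} zero    = cong suc (sum-replicate-zero k)
∑δ≡1 {suc k} (suc i) = ∑δ≡1 i

indicator : ∀ {k} → Maybe (Fin k) → Fin k → ℕ
indicator nothing  _ = 0
indicator (just i) j = δ i j

occupancy : ∀ {k} → Maybe (Fin k) → ℕ
occupancy nothing  = 0
occupancy (just _) = 1

indicator≤1 : ∀ {k} (m : Maybe (Fin k)) j → indicator m j ≤ 1
indicator≤1 nothing  j = z≤n
indicator≤1 (just i) j = δ≤1 i j

indicator≡1⇒≡just : ∀ {k} (m : Maybe (Fin k)) j → indicator m j ≡ 1 → m ≡ just j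
indicator≡1⇒≡just (just i) j e = cong just (δ≡1⇒≡ i j e)

occupancy≡∑indicator : ∀ {k} (m : Maybe (Fin k)) → occupancy m ≡ ∑[ j < k ] indicator m j
occupancy≡∑indicator {k} nothing  = sym (sum-replicate-zero k)
occupancy≡∑indicator     (just i) = sym (∑δ≡1 i)

occupancy≡0⇒≡nothing : ∀ {k} (m : Maybe (Fin k)) → occupancy m ≡ 0 → m ≡ nothing
occupancy≡0⇒≡nothing nothing _ = refl

-- Unsigned divisibility, so that it unfolds to the condition in IsEPSSchedule.
_≡_[mod_] : ℤ → ℤ → ℕ → Set
x ≡ y [mod a ] = + a ℤD.∣ x - y

mod-sym : ∀ {a} x y → x ≡ y [mod a ] → y ≡ x [mod a ]
mod-sym {a} x y = subst (a ∣_) (ℤP.∣i-j∣≡∣j-i∣ x y)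

mod-trans : ∀ {a} x y z → x ≡ y [mod a ] → y ≡ z [mod a ] → x ≡ z [mod a ]
mod-trans {a} x y z x≡y y≡z = ℤS.∣⇒∣ᵤ {+ a} {x - z}
  (subst (ℤS._∣_ (+ a)) (telescope x y z)
    (ℤS.∣m∣n⇒∣m+n (ℤS.∣ᵤ⇒∣ {+ a} {x - y} x≡y) (ℤS.∣ᵤ⇒∣ {+ a} {y - z} y≡z)))
  where
  telescope : ∀ x y z → (x - y) ℤ.+ (y - z) ≡ x - z
  telescope = ℤSolver.solve-∀

mod-divisor : ∀ {a b} x y → a ∣ b → x ≡ y [mod b ] → x ≡ y [mod a ]
mod-divisor _ _ = ∣-trans

∣∧<⇒≡0 : ∀ {a m} → a ∣ m → m < a → m ≡ 0
∣∧<⇒≡0 {m = zero}  _   _   = refl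
∣∧<⇒≡0 {m = suc _} a∣m m<a = contradiction a∣m (>⇒∤ m<a)

mod-unique : ∀ {a x y} → x ≡ y [mod a ] → ∣ x - y ∣ < a → x ≡ y
mod-unique {x = x} {y} x≡y dist<a = ℤP.i-j≡0⇒i≡j x y (ℤP.∣i∣≡0⇒i≡0 (∣∧<⇒≡0 x≡y dist<a))

∣shifted-difference∣< : ∀ {a} s {x y} → x < a → y < a → ∣ + (s + x) - + (s + y) ∣ < a
∣shifted-difference∣< s {x} {y} x<a y<a = subst (_< _) (sym (cong ∣_∣ shift))
  (≤-<-trans (ℤP.∣m⊝n∣≤m⊔n x y) (⊔-lub x<a y<a))
  where
  shift : + (s + x) - + (s + y) ≡ x ℤ.⊖ y
  shift = trans (ℤP.m-n≡m⊖n (s + x) (s + y)) (ℤP.+-cancelˡ-⊖ s x y)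

module Snoc (b : ℕ) where

  inject : ∀ A → Fin (length A) → Fin (length (A ++ [ b ]))
  inject (_ ∷ A) zero    = zero
  inject (_ ∷ A) (suc i) = suc (inject A i)

  newIndex : ∀ A → Fin (length (A ++ [ b ]))
  newIndex []      = zero
  newIndex (_ ∷ A) = suc (newIndex A)

  data View (A : List ℕ) : Fin (length (A ++ [ b ])) → Set where
    old : ∀ i → View A (inject A i)
    new : View A (newIndex A)

  view : ∀ A j → View A j
  view []      zero    = new
  view (_ ∷ A) zero    = old zero
  view (_ ∷ A) (suc j) with view A j
  ... | old i = old (suc i)
  ... | new   = new

  lookup-inject : ∀ A i → lookup (A ++ [ b ]) (inject A i) ≡ lookup A i
  lookup-inject (_ ∷ A) zero    = refl
  lookup-inject (_ ∷ A) (suc i) = lookup-inject A i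

  lookup-newIndex : ∀ A → lookup (A ++ [ b ]) (newIndex A) ≡ b
  lookup-newIndex []      = refl
  lookup-newIndex (_ ∷ A) = lookup-newIndex A

  inject-injective : ∀ A {i j} → inject A i ≡ inject A j → i ≡ j
  inject-injective (_ ∷ A) {zero}  {zero}  _ = refl
  inject-injective (_ ∷ A) {suc i} {suc j} e = cong suc (inject-injective A (FinP.suc-injective e))

  newIndex≢inject : ∀ A i → newIndex A ≢ inject A i
  newIndex≢inject (_ ∷ A) (suc i) e = newIndex≢inject A i (FinP.suc-injective e)

  map-inject≡just-inject : ∀ A m {i} → Maybe.map (inject A) m ≡ just (inject A i) → m ≡ just i
  map-inject≡just-inject A (just j) e = cong just (inject-injective A (just-injective e))

  map-inject≢just-newIndex : ∀ A m → Maybe.map (inject A) m ≢ just (newIndex A)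
  map-inject≢just-newIndex A (just j) e = newIndex≢inject A j (sym (just-injective e))

∑quotients : ∀ {b xs} → All (_∣ b) xs → ℕ
∑quotients []                 = 0
∑quotients (divides q _ ∷ ds) = q + ∑quotients ds

∑quotients-++ : ∀ {b xs y} (ds : All (_∣ b) xs) (y∣b : y ∣ b) →
  ∑quotients (++⁺ ds (y∣b ∷ [])) ≡ ∑quotients ds + _∣_.quotient y∣b
∑quotients-++ []                 (divides q _) = +-comm q 0
∑quotients-++ (divides q _ ∷ ds) y∣b           = trans (cong (_+_ q) (∑quotients-++ ds y∣b)) (sym (+-assoc q _ _))

∑quotients≡∑ : ∀ {b xs} (ds : All (_∣ b) xs) →
  ∑[ i < length xs ] _∣_.quotient (All.lookup ds (∈-lookup i)) ≡ ∑quotients ds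
∑quotients≡∑ []                 = refl
∑quotients≡∑ (divides q _ ∷ ds) = cong (_+_ q) (∑quotients≡∑ ds)

module _ {A : List ℕ} {σ : ℤ → Maybe (Fin (length A))} (schedule : IsEPSSchedule A σ) where

  private
    offset : Fin (length A) → ℤ
    offset i = proj₁ (schedule i)

    σ≡just⇒mod : ∀ {i t} → σ t ≡ just i → t ≡ offset i [mod lookup A i ]
    σ≡just⇒mod {i} {t} = Equivalence.to (proj₂ (schedule i) t)

    mod⇒σ≡just : ∀ {i t} → t ≡ offset i [mod lookup A i ] → σ t ≡ just i
    mod⇒σ≡just {i} {t} = Equivalence.from (proj₂ (schedule i) t)

    hits : Fin (length A) → ℕ → ℕ
    hits i t = indicator (σ (+ t)) i

  hits≤quotient : ∀ {b} i (a∣b : lookup A i ∣ b) → sumBelow b (hits i) ≤ _∣_.quotient a∣b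
  hits≤quotient i (divides q refl) = sumBelow-blocks q (lookup A i) (hits i) window
    where
    window : ∀ s → sumBelow (lookup A i) (λ t → hits i (s + t)) ≤ 1
    window s = sumBelow≤1 (lookup A i) (λ t → hits i (s + t)) (λ t → indicator≤1 (σ (+ (s + t))) i)
      λ {x} {y} x<a y<a hx hy → +-cancelˡ-≡ s x y (ℤP.+-injective (mod-unique
        (mod-trans (+ (s + x)) (offset i) (+ (s + y)) (hit⇒mod (s + x) hx) (mod-sym (+ (s + y)) (offset i) (hit⇒mod (s + y) hy)))
        (∣shifted-difference∣< s x<a y<a)))
      where
      hit⇒mod : ∀ t → hits i t ≡ 1 → (+ t) ≡ offset i [mod lookup A i ]
      hit⇒mod t = σ≡just⇒mod ∘ indicator≡1⇒≡just (σ (+ t)) i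

  occupied≤∑quotients : ∀ {b} (ds : All (_∣ b) A) → sumBelow b (occupancy ∘ σ ∘ +_) ≤ ∑quotients ds
  occupied≤∑quotients {b} ds = begin
    sumBelow b (occupancy ∘ σ ∘ +_)                                 ≡⟨ sumBelow-cong b (occupancy≡∑indicator ∘ σ ∘ +_) ⟩
    sumBelow b (λ t → ∑[ i < length A ] hits i t)                   ≡⟨ sumBelow-∑ b hits ⟩
    ∑[ i < length A ] sumBelow b (hits i)                           ≤⟨ ∑-mono-≤ (λ i → hits≤quotient i (All.lookup ds (∈-lookup i))) ⟩
    ∑[ i < length A ] _∣_.quotient (All.lookup ds (∈-lookup i))     ≡⟨ ∑quotients≡∑ ds ⟩
    ∑quotients ds                                                   ∎
    where open ≤-Reasoning

  freeSlot : ∀ {b} (ds : All (_∣ b) A) → ∑quotients ds < b → ∃[ t ] σ (+ t) ≡ nothing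
  freeSlot {b} ds lt with sumBelow<n⇒∃zero b (occupancy ∘ σ ∘ +_) (≤-<-trans (occupied≤∑quotients ds) lt)
  ... | t , occ≡0 = t , occupancy≡0⇒≡nothing (σ (+ t)) occ≡0

  addTaskAt : ∀ {b} → All (_∣ b) A → ∀ t → σ t ≡ nothing → HasEPS (A ++ [ b ])
  addTaskAt {b} ds t free = σ′ , schedule′
    where
    open Snoc b

    choose : ∀ {P : Set} → Dec P → Maybe (Fin (length A)) → Maybe (Fin (length (A ++ [ b ])))
    choose (yes _) _ = just (newIndex A)
    choose (no _)  m = Maybe.map (inject A) m

    σ′ : ℤ → Maybe (Fin (length (A ++ [ b ])))
    σ′ u = choose (b ∣? ∣ u - t ∣) (σ u)

    -- A slot of the new task is congruent to t modulo a, so it cannot belong to task i.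
    oldTask : ∀ i u (d : Dec (u ≡ t [mod b ])) →
      (choose d (σ u) ≡ just (inject A i)) ⇔ u ≡ offset i [mod lookup A i ]
    oldTask i u (yes u≡t) = mk⇔
      (λ e → contradiction (just-injective e) (newIndex≢inject A i))
      (λ u≡r → contradiction (trans (sym free) (mod⇒σ≡just (t≡offset u≡r))) λ ())
      where
      t≡offset : u ≡ offset i [mod lookup A i ] → t ≡ offset i [mod lookup A i ]
      t≡offset = mod-trans t u (offset i) (mod-sym u t (mod-divisor u t (All.lookup ds (∈-lookup i)) u≡t))
    oldTask i u (no _) = mk⇔
      (σ≡just⇒mod ∘ map-inject≡just-inject A (σ u))
      (cong (Maybe.map (inject A)) ∘ mod⇒σ≡just)

    newTask : ∀ u (d : Dec (u ≡ t [mod b ])) → (choose d (σ u) ≡ just (newIndex A)) ⇔ u ≡ t [mod b ]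
    newTask u (yes u≡t) = mk⇔ (λ _ → u≡t) (λ _ → refl)
    newTask u (no u≢t)  = mk⇔ (λ e → contradiction e (map-inject≢just-newIndex A (σ u))) (λ u≡t → contradiction u≡t u≢t)

    schedule′ : IsEPSSchedule (A ++ [ b ]) σ′
    schedule′ j with view A j
    ... | old i = offset i , λ u → subst (λ a → (σ′ u ≡ just (inject A i)) ⇔ u ≡ offset i [mod a ])
                                         (sym (lookup-inject A i)) (oldTask i u (b ∣? ∣ u - t ∣))
    ... | new   = t , λ u → subst (λ a → (σ′ u ≡ just (newIndex A)) ⇔ u ≡ t [mod a ])
                                  (sym (lookup-newIndex A)) (newTask u (b ∣? ∣ u - t ∣))

addMultiple : ∀ A {b} (ds : All (_∣ b) A) → HasEPS A → ∑quotients ds < b → HasEPS (A ++ [ b ])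
addMultiple A ds (σ , schedule) lt with freeSlot schedule ds lt
... | t , free = addTaskAt schedule ds (+ t) free

recipᵘ : ℕ → ℚᵘ
recipᵘ zero    = 0ℚᵘ
recipᵘ (suc n) = mkℚᵘ (+ 1) n

Dᵘ : List ℕ → ℚᵘ
Dᵘ = foldr (λ x s → recipᵘ x ℚᵘ.+ s) 0ℚᵘ

toℚᵘ-recip : ∀ x → toℚᵘ (recip x) ≃ recipᵘ x
toℚᵘ-recip zero    = ℚᵘP.≃-refl
toℚᵘ-recip (suc n) = ℚP.toℚᵘ-fromℚᵘ (mkℚᵘ (+ 1) n)

toℚᵘ-D : ∀ xs → toℚᵘ (D xs) ≃ Dᵘ xs
toℚᵘ-D []       = ℚᵘP.≃-refl
toℚᵘ-D (x ∷ xs) = ℚᵘP.≃-trans (ℚP.toℚᵘ-homo-+ (recip x) (D xs)) (ℚᵘP.+-cong (toℚᵘ-recip x) (toℚᵘ-D xs))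

recipᵘ-nonneg : ∀ x → 0ℚᵘ ℚᵘ.≤ recipᵘ x
recipᵘ-nonneg zero    = ℚᵘP.≤-refl
recipᵘ-nonneg (suc n) = *≤* (ℤ.+≤+ z≤n)

Dᵘ-nonneg : ∀ xs → 0ℚᵘ ℚᵘ.≤ Dᵘ xs
Dᵘ-nonneg []       = ℚᵘP.≤-refl
Dᵘ-nonneg (x ∷ xs) = ℚᵘP.+-mono-≤ (recipᵘ-nonneg x) (Dᵘ-nonneg xs)

Dᵘ-++-≤ : ∀ xs ys → Dᵘ xs ℚᵘ.≤ Dᵘ (xs ++ ys)
Dᵘ-++-≤ []       ys = Dᵘ-nonneg ys
Dᵘ-++-≤ (x ∷ xs) ys = ℚᵘP.+-monoʳ-≤ (recipᵘ x) (Dᵘ-++-≤ xs ys)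

recip+≃ : ∀ {x b q} S → suc b ≡ q * suc x → mkℚᵘ (+ 1) x ℚᵘ.+ mkℚᵘ (+ S) b ≃ mkℚᵘ (+ (q + S)) b
recip+≃ {x} {b} {q} S b≡qx = *≡* (trans
  (cross (+ suc b) (+ q) (+ suc x) (+ S) (trans (cong +_ b≡qx) (ℤP.pos-* q (suc x))))
  (cong (+ (q + S) ℤ.*_) (sym (ℤP.pos-* (suc x) (suc b)))))
  where
  cross : ∀ B Q X S → B ≡ Q ℤ.* X → (+ 1 ℤ.* B ℤ.+ S ℤ.* X) ℤ.* B ≡ (Q ℤ.+ S) ℤ.* (X ℤ.* B)
  cross _ Q X S refl = identity Q X S
    where
    identity : ∀ Q X S → (+ 1 ℤ.* (Q ℤ.* X) ℤ.+ S ℤ.* X) ℤ.* (Q ℤ.* X) ≡ (Q ℤ.+ S) ℤ.* (X ℤ.* (Q ℤ.* X))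
    identity = ℤSolver.solve-∀

Dᵘ≃∑quotients : ∀ {b} xs (ds : All (_∣ suc b) xs) → Dᵘ xs ≃ mkℚᵘ (+ ∑quotients ds) b
Dᵘ≃∑quotients []            []                 = *≡* refl
Dᵘ≃∑quotients (suc x ∷ xs) (divides q b≡qx ∷ ds) =
  ℚᵘP.≃-trans (ℚᵘP.+-congʳ (recipᵘ (suc x)) (Dᵘ≃∑quotients xs ds)) (recip+≃ (∑quotients ds) b≡qx)
Dᵘ≃∑quotients (zero ∷ _)   (divides q b≡q*0 ∷ _) with () ← trans b≡q*0 (*-zeroʳ q)

∑quotients<b : ∀ A {b} (ds : All (_∣ suc b) A) → Dᵘ (A ++ [ suc b ]) ℚᵘ.≤ 1ℚᵘ → ∑quotients ds < suc b
∑quotients<b A {b} ds D≤1 with ℚᵘP.≤-respˡ-≃ (Dᵘ≃∑quotients (A ++ [ suc b ]) (++⁺ ds (∣-refl ∷ []))) D≤1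
... | *≤* S*1≤1*b rewrite ℤP.*-identityʳ (+ ∑quotients (++⁺ ds (∣-refl ∷ []))) | ℤP.*-identityˡ (+ suc b)
                        | ∑quotients-++ ds (∣-refl {suc b}) =
  subst (_≤ suc b) (+-comm (∑quotients ds) 1) (ℤP.drop‿+≤+ S*1≤1*b)

addMultiples : ∀ A B → HasEPS A → All (0 <_) B → All (λ b → All (_∣ b) A) B → AllPairs _∣_ B →
  Dᵘ (A ++ B) ℚᵘ.≤ 1ℚᵘ → HasEPS (A ++ B)
addMultiples A [] hasEPS _ _ _ _ = subst HasEPS (sym (++-identityʳ A)) hasEPS
addMultiples A (suc b ∷ B) hasEPS (s≤s _ ∷ B>0) (A∣b ∷ A∣B) (b∣B ∷ B-chain) D≤1 =
  subst HasEPS (++-assoc A [ suc b ] B) (addMultiples (A ++ [ suc b ]) B hasEPS′ B>0 A∷b∣B B-chain D′≤1)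
  where
  D′≤1 : Dᵘ ((A ++ [ suc b ]) ++ B) ℚᵘ.≤ 1ℚᵘ
  D′≤1 = subst (λ xs → Dᵘ xs ℚᵘ.≤ 1ℚᵘ) (sym (++-assoc A [ suc b ] B)) D≤1

  hasEPS′ : HasEPS (A ++ [ suc b ])
  hasEPS′ = addMultiple A A∣b hasEPS (∑quotients<b A A∣b (ℚᵘP.≤-trans (Dᵘ-++-≤ (A ++ [ suc b ]) B) D′≤1))

  A∷b∣B : All (λ c → All (_∣ c) (A ++ [ suc b ])) B
  A∷b∣B = All.zipWith (λ (A∣c , b∣c) → ++⁺ A∣c (b∣c ∷ [])) (A∣B , b∣B)

∣lcmList : ∀ A → All (_∣ lcmList A) A
∣lcmList []      = []
∣lcmList (x ∷ A) = m∣lcm[m,n] x (lcmList A) ∷ All.map (λ d → ∣-trans d (n∣lcm[m,n] x (lcmList A))) (∣lcmList A)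

All-fromLookup : ∀ {P : ℕ → Set} xs → (∀ i → P (lookup xs i)) → All P xs
All-fromLookup {P} xs p = All.tabulate λ x∈xs → subst P (sym (lookup-index x∈xs)) (p (Any.index x∈xs))

monotone⇒AllPairs : ∀ xs → ((i j : Fin (length xs)) → i ≤ᶠ j → lookup xs i ∣ lookup xs j) → AllPairs _∣_ xs
monotone⇒AllPairs []       _     = []
monotone⇒AllPairs (x ∷ xs) chain =
  All-fromLookup xs (λ j → chain zero (suc j) z≤n) ∷ monotone⇒AllPairs xs (λ i j i≤j → chain (suc i) (suc j) (s≤s i≤j))

lemma7 : (A B : List ℕ) →
    All (0 <_) A → All (0 <_) B →
    HasEPS A →
    All (λ b → lcmList A ∣ b) B →
    ((i j : Fin (length B)) → i ≤ᶠ j → lookup B i ∣ lookup B j) →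
    D (A ++ B) ≤ℚ 1ℚ →
    HasEPS (A ++ B)
lemma7 A B _ B>0 hasEPS L∣B chain D≤1 =
  addMultiples A B hasEPS B>0 A∣B (monotone⇒AllPairs B chain)
    (ℚᵘP.≤-respˡ-≃ (toℚᵘ-D (A ++ B)) (ℚP.toℚᵘ-mono-≤ D≤1))
  where
  A∣B : All (λ b → All (_∣ b) A) B
  A∣B = All.map (λ L∣b → All.map (λ a∣L → ∣-trans a∣L L∣b) (∣lcmList A)) L∣B
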